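{- Let $n \ge 1$. The (deterministic) fragile complexity of finding the minimum of $n$ elements is exactly $\lceil \log_2 n \rceil$. That is: (i) there is a deterministic comparison-based algorithm that finds the minimum of any $n$ elements in which every element participates in at most $\lceil \log_2 n\rceil$ comparisons; and (ii) for every deterministic comparison-based algorithm that finds the minimum of $n$ elements, there is an input on which the minimum element participates in at least $\lceil \log_2 n\rceil$ comparisons.
   Context: Inputs are elements of a totally ordered set, accessed only through pairwise comparisons. A comparison-based algorithm has fragile complexity $f(n)$ if on every input of size $n$ each individual input element participates in at most $f(n)$ comparisons; it has work $w(n)$ if it performs at most $w(n)$ comparisons in total. -}

module Defs where

open import Data.Nat using (ℕ; zero; suc; _+_; _<?_; _≤_)
open import Data.Fin using (Fin; _≟_)
open import Data.Bool using (Bool; true; false; if_then_else_; _∨_)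
open import Relation.Nullary using (does)
open import Function.Definitions using (Injective)
open import Relation.Binary.PropositionalEquality using (_≡_)

-- A deterministic comparison-based algorithm on n inputs x₀ … x_{n-1}:
-- a (finite) decision tree.  An internal node `cmp i j l r` compares
-- x i with x j and continues in l if x i < x j, otherwise in r.
-- A leaf `out m` outputs the index m (the claimed position of the minimum).
data Alg (n : ℕ) : Set where
  out : Fin n → Alg n
  cmp : Fin n → Fin n → Alg n → Alg n → Alg n

-- Inputs: n pairwise-distinct elements of a totally ordered set (ℕ).
Input : ℕ → Set
Input n = Fin n → ℕ

Distinct : ∀ {n} → Input n → Set
Distinct x = Injective _≡_ _≡_ x

run : ∀ {n} → Alg n → Input n → Fin n
run (out m) x = m
run (cmp i j l r) x = if does (x i <? x j) then run l x else run r x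

participation : ∀ {n} → Alg n → Input n → Fin n → ℕ
participation (out m) x k = 0
participation (cmp i j l r) x k =
  (if does (i ≟ k) ∨ does (j ≟ k) then 1 else 0)
  + (if does (x i <? x j) then participation l x k else participation r x k)

IsMinPos : ∀ {n} → Input n → Fin n → Set
IsMinPos x m = ∀ j → x m ≤ x j

FindsMin : ∀ {n} → Alg n → Set
FindsMin {n} A = (x : Input n) → Distinct x → IsMinPos x (run A x)

module Submission where

-- Upper bound: a knockout tournament on the index intervals [lo, lo + 2^d). Every element
-- plays at most one game per round, and ⌈log₂ n⌉ rounds cover all n indices.
--
-- Lower bound: an adversary gives every element weight 1 and answers comparisons as follows.
-- Of two surviving candidates the heavier one is declared smaller and absorbs the weight of the
-- other, which is eliminated; a candidate is smaller than every eliminated element; and of two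
-- eliminated elements the one eliminated later is smaller. The total weight stays n, and a
-- candidate's weight at most doubles each time it is compared. A correct algorithm must end with
-- a single candidate -- the reported minimum -- which therefore carries weight n, so it took part
-- in at least log₂ n comparisons. The answers are realised by an honest input built at the end.

open import Defs
import Algebra.Properties.CommutativeMonoid.Sum as Sum
open import Data.Bool using (Bool; true; false; if_then_else_; _∨_)
open import Data.Bool.Properties using (∨-comm)
open import Data.Empty using (⊥-elim)
open import Data.Fin using (Fin; zero; suc; toℕ; fromℕ<; _≟_; opposite)
open import Data.Fin.Properties using (toℕ<n; toℕ-injective; toℕ-fromℕ<; opposite-prop; opposite-involutive)
open import Data.Maybe using (Maybe; just; nothing)
open import Data.Nat using (ℕ; zero; suc; _+_; _*_; _∸_; _^_; _≤_; _<_; _<?_; _≤?_; z≤n; s≤s⁻¹; ⌈_/2⌉)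
open import Data.Nat.Induction using (<-wellFounded)
open import Data.Nat.Logarithm using (⌈log₂_⌉; ⌈log₂⌉-mono-≤; ⌈log₂2^n⌉≡n)
open import Data.Nat.Logarithm.Core using (⌈log2⌉)
open import Data.Nat.Properties hiding (_≟_)
open import Data.Product using (Σ; _×_; _,_; proj₁; proj₂)
open import Data.Sum using (inj₁; inj₂)
open import Function using (_∘_)
open import Function.Definitions using (Injective)
open import Induction.WellFounded using (Acc; acc)
open import Level using (0ℓ)
open import Relation.Binary.PropositionalEquality
open import Relation.Nullary using (¬_; does; proof; yes; no; ofʸ; ofⁿ)
open import Relation.Nullary.Decidable using (dec-true; dec-false)
open import Relation.Unary using (Pred; _∪_; _⊥_; _⊆_; _≐_; Empty)

open Sum +-0-commutativeMonoid using (sum; ∑-distrib-+; sum-cong-≗; sum-replicate-zero)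

pointMass : ∀ {n} → Fin n → ℕ → Fin n → ℕ
pointMass a v k = if does (k ≟ a) then v else 0

sum-pointMass : ∀ {n} (a : Fin n) v → sum (pointMass a v) ≡ v
sum-pointMass {suc n} zero v = trans (cong (v +_) (sum-replicate-zero n)) (+-identityʳ v)
sum-pointMass {suc n} (suc a) v = sum-pointMass a v

sum-concentrated : ∀ {n} (f : Fin n → ℕ) m → (∀ k → k ≢ m → f k ≡ 0) → sum f ≡ f m
sum-concentrated f m off-m = trans (sum-cong-≗ f≗) (sum-pointMass m (f m))
  where
  f≗ : ∀ k → f k ≡ pointMass m (f m) k
  f≗ k with k ≟ m
  ... | yes refl = refl
  ... | no k≢m = off-m k k≢m

sum-ones : ∀ n → sum {n} (λ _ → 1) ≡ n
sum-ones zero = refl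
sum-ones (suc n) = cong suc (sum-ones n)

transfer : ∀ {n} → Fin n → Fin n → (Fin n → ℕ) → Fin n → ℕ
transfer a b w k = if does (k ≟ a) then w a + w b else if does (k ≟ b) then 0 else w k

sum-transfer : ∀ {n} {a b : Fin n} w → a ≢ b → sum (transfer a b w) ≡ sum w
sum-transfer {a = a} {b} w a≢b = +-cancelʳ-≡ (w b) _ _ (begin
  sum (transfer a b w) + w b                       ≡⟨ cong (sum (transfer a b w) +_) (sum-pointMass b (w b)) ⟨
  sum (transfer a b w) + sum (pointMass b (w b))  ≡⟨ ∑-distrib-+ (transfer a b w) (pointMass b (w b)) ⟨
  sum (λ k → transfer a b w k + pointMass b (w b) k) ≡⟨ sum-cong-≗ moved ⟩
  sum (λ k → w k + pointMass a (w b) k)            ≡⟨ ∑-distrib-+ w (pointMass a (w b)) ⟩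
  sum w + sum (pointMass a (w b))                  ≡⟨ cong (sum w +_) (sum-pointMass a (w b)) ⟩
  sum w + w b                                      ∎)
  where
  open ≡-Reasoning
  moved : ∀ k → transfer a b w k + pointMass b (w b) k ≡ w k + pointMass a (w b) k
  moved k with k ≟ a | k ≟ b
  ... | yes refl | yes refl = ⊥-elim (a≢b refl)
  ... | yes refl | no _ = +-identityʳ _
  ... | no _ | yes refl = +-comm 0 (w k)
  ... | no _ | no _ = refl

touches : ∀ {n} → Fin n → Fin n → Fin n → ℕ
touches a b e = if does (a ≟ e) ∨ does (b ≟ e) then 1 else 0

touches-comm : ∀ {n} (a b e : Fin n) → touches a b e ≡ touches b a e
touches-comm a b e = cong (λ c → if c then 1 else 0) (∨-comm (does (a ≟ e)) (does (b ≟ e)))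

touches-left : ∀ {n} (a b : Fin n) → touches a b a ≡ 1
touches-left a b with a ≟ a
... | yes _ = refl
... | no a≢a = ⊥-elim (a≢a refl)

run-cmp : ∀ {n} i j l r (x : Input n) {b} → does (x i <? x j) ≡ b →
  run (cmp i j l r) x ≡ run (if b then l else r) x
run-cmp i j l r x {true} eq = cong (λ c → if c then run l x else run r x) eq
run-cmp i j l r x {false} eq = cong (λ c → if c then run l x else run r x) eq

participation-cmp : ∀ {n} i j l r (x : Input n) k {b} → does (x i <? x j) ≡ b →
  participation (cmp i j l r) x k ≡ touches i j k + participation (if b then l else r) x k
participation-cmp i j l r x k {true} eq =
  cong (λ c → touches i j k + (if c then participation l x k else participation r x k)) eq
participation-cmp i j l r x k {false} eq =
  cong (λ c → touches i j k + (if c then participation l x k else participation r x k)) eq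

m≤m*2^e : ∀ m e → m ≤ m * 2 ^ e
m≤m*2^e m e = subst (_≤ m * 2 ^ e) (*-identityʳ m) (*-monoʳ-≤ m (m^n>0 2 e))

*2^-trans : ∀ {a b c} e f → a ≤ b * 2 ^ e → b ≤ c * 2 ^ f → a ≤ c * 2 ^ (f + e)
*2^-trans {a} {b} {c} e f a≤b2^e b≤c2^f = begin
  a                   ≤⟨ a≤b2^e ⟩
  b * 2 ^ e           ≤⟨ *-monoˡ-≤ (2 ^ e) b≤c2^f ⟩
  c * 2 ^ f * 2 ^ e   ≡⟨ *-assoc c (2 ^ f) (2 ^ e) ⟩
  c * (2 ^ f * 2 ^ e) ≡⟨ cong (c *_) (^-distribˡ-+-* 2 f e) ⟨
  c * 2 ^ (f + e)     ∎
  where open ≤-Reasoning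

opposite-reverses : ∀ {n} {i j : Fin n} → toℕ (opposite i) ≤ toℕ (opposite j) → toℕ j ≤ toℕ i
opposite-reverses {i = i} {j} le = s≤s⁻¹ (∸-cancelʳ-≤ (toℕ<n j)
  (subst₂ _≤_ (opposite-prop i) (opposite-prop j) le))

⌈log₂⌉-≤ : ∀ {m p} → m ≤ 2 ^ p → ⌈log₂ m ⌉ ≤ p
⌈log₂⌉-≤ {p = p} m≤2^p = subst (_ ≤_) (⌈log₂2^n⌉≡n p) (⌈log₂⌉-mono-≤ m≤2^p)

n≤⌈n/2⌉+⌈n/2⌉ : ∀ n → n ≤ ⌈ n /2⌉ + ⌈ n /2⌉
n≤⌈n/2⌉+⌈n/2⌉ n =
  subst (_≤ ⌈ n /2⌉ + ⌈ n /2⌉) (⌊n/2⌋+⌈n/2⌉≡n n) (+-monoˡ-≤ ⌈ n /2⌉ (⌊n/2⌋≤⌈n/2⌉ n))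

n≤2^⌈log2⌉n : ∀ n (rec : Acc _<_ n) → n ≤ 2 ^ ⌈log2⌉ n rec
n≤2^⌈log2⌉n zero _ = z≤n
n≤2^⌈log2⌉n (suc zero) _ = ≤-refl
n≤2^⌈log2⌉n n@(suc (suc k)) (acc rs) = begin
  n                   ≤⟨ n≤⌈n/2⌉+⌈n/2⌉ n ⟩
  ⌈ n /2⌉ + ⌈ n /2⌉   ≤⟨ +-mono-≤ IH IH ⟩
  2 ^ L + 2 ^ L       ≡⟨ cong (2 ^ L +_) (+-identityʳ (2 ^ L)) ⟨
  2 ^ suc L           ∎
  where
  open ≤-Reasoning
  L = ⌈log2⌉ ⌈ n /2⌉ (rs (⌈n/2⌉<n k))
  IH = n≤2^⌈log2⌉n ⌈ n /2⌉ (rs (⌈n/2⌉<n k))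

n≤2^⌈log₂n⌉ : ∀ n → n ≤ 2 ^ ⌈log₂ n ⌉
n≤2^⌈log₂n⌉ n = n≤2^⌈log2⌉n n (<-wellFounded n)

module _ {n : ℕ} where

  Winner : Pred (Fin n) 0ℓ → Input n → Maybe (Fin n) → Set
  Winner P x nothing = Empty P
  Winner P x (just m) = P m × (∀ {e} → P e → x m ≤ x e)

  winner-∉ : ∀ {P x w e} → Winner P x w → ¬ P e → w ≢ just e
  winner-∉ (Pm , _) ¬Pe refl = ¬Pe Pm

  -- games k plays a knockout among the elements satisfying P, then continues as k applied to
  -- the winner (nothing if P is empty).
  record Tournament (P : Pred (Fin n) 0ℓ) (d : ℕ) : Set where
    field
      games : (Maybe (Fin n) → Alg n) → Alg n
      winner : Input n → Maybe (Fin n)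
      winner-correct : ∀ x → Winner P x (winner x)
      run-games : ∀ k x → run (games k) x ≡ run (k (winner x)) x
      participation-∈ : ∀ k x {e} → P e →
        participation (games k) x e ≤ d + participation (k (winner x)) x e
      participation-∉ : ∀ k x {e} → ¬ P e →
        participation (games k) x e ≡ participation (k (winner x)) x e

  open Tournament

  walkover : ∀ {P} (w : Maybe (Fin n)) → (∀ x → Winner P x w) → Tournament P 0
  walkover w correct = record
    { games = λ k → k w
    ; winner = λ _ → w
    ; winner-correct = correct
    ; run-games = λ _ _ → refl
    ; participation-∈ = λ _ _ _ → ≤-refl
    ; participation-∉ = λ _ _ _ → refl
    }

  better : Input n → Maybe (Fin n) → Maybe (Fin n) → Maybe (Fin n)
  better x (just a) (just b) = if does (x a <? x b) then just a else just b
  better x (just a) nothing = just a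
  better x nothing v = v

  match : Maybe (Fin n) → Maybe (Fin n) → (Maybe (Fin n) → Alg n) → Alg n
  match (just a) (just b) k = cmp a b (k (just a)) (k (just b))
  match (just a) nothing k = k (just a)
  match nothing v k = k v

  run-match : ∀ u v k x → run (match u v k) x ≡ run (k (better x u v)) x
  run-match (just a) (just b) k x with does (x a <? x b)
  ... | true = refl
  ... | false = refl
  run-match (just a) nothing k x = refl
  run-match nothing v k x = refl

  touches≤1 : ∀ (a b e : Fin n) → touches a b e ≤ 1
  touches≤1 a b e with does (a ≟ e) ∨ does (b ≟ e)
  ... | true = ≤-refl
  ... | false = z≤n

  touches≡0 : ∀ {a b e : Fin n} → a ≢ e → b ≢ e → touches a b e ≡ 0
  touches≡0 {a} {b} {e} a≢e b≢e with a ≟ e | b ≟ e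
  ... | yes a≡e | _ = ⊥-elim (a≢e a≡e)
  ... | no _ | yes b≡e = ⊥-elim (b≢e b≡e)
  ... | no _ | no _ = refl

  participation-match : ∀ u v k x e →
    participation (match u v k) x e ≤ 1 + participation (k (better x u v)) x e
  participation-match (just a) (just b) k x e with does (x a <? x b)
  ... | true = +-monoˡ-≤ _ (touches≤1 a b e)
  ... | false = +-monoˡ-≤ _ (touches≤1 a b e)
  participation-match (just a) nothing k x e = n≤1+n _
  participation-match nothing v k x e = n≤1+n _

  participation-match-∉ : ∀ u v k x e → u ≢ just e → v ≢ just e →
    participation (match u v k) x e ≡ participation (k (better x u v)) x e
  participation-match-∉ (just a) (just b) k x e a≢e b≢e with does (x a <? x b)
  ... | true = cong (_+ _) (touches≡0 {a} {b} (λ { refl → a≢e refl }) λ { refl → b≢e refl })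
  ... | false = cong (_+ _) (touches≡0 {a} {b} (λ { refl → a≢e refl }) λ { refl → b≢e refl })
  participation-match-∉ (just a) nothing k x e _ _ = refl
  participation-match-∉ nothing v k x e _ _ = refl

  winner-better : ∀ {P Q x} u v → Winner P x u → Winner Q x v → Winner (P ∪ Q) x (better x u v)
  winner-better {x = x} (just a) (just b) (Pa , a-min) (Qb , b-min)
    with does (x a <? x b) | proof (x a <? x b)
  ... | true | ofʸ a<b =
    inj₁ Pa , λ { (inj₁ Pe) → a-min Pe ; (inj₂ Qe) → ≤-trans (<⇒≤ a<b) (b-min Qe) }
  ... | false | ofⁿ a≮b =
    inj₂ Qb , λ { (inj₁ Pe) → ≤-trans (≮⇒≥ a≮b) (a-min Pe) ; (inj₂ Qe) → b-min Qe }
  winner-better (just a) nothing (Pa , a-min) ∅Q =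
    inj₁ Pa , λ { (inj₁ Pe) → a-min Pe ; (inj₂ Qe) → ⊥-elim (∅Q _ Qe) }
  winner-better nothing (just b) ∅P (Qb , b-min) =
    inj₂ Qb , λ { (inj₁ Pe) → ⊥-elim (∅P _ Pe) ; (inj₂ Qe) → b-min Qe }
  winner-better nothing nothing ∅P ∅Q _ (inj₁ Pe) = ∅P _ Pe
  winner-better nothing nothing ∅P ∅Q _ (inj₂ Qe) = ∅Q _ Qe

  finalMatch : ∀ {P Q d} → P ⊥ Q → Tournament P d → Tournament Q d → Tournament (P ∪ Q) (suc d)
  finalMatch {P} {Q} {d} P⊥Q L R = record
    { games = bracket
    ; winner = λ x → better x (winner L x) (winner R x)
    ; winner-correct = λ x → winner-better _ _ (winner-correct L x) (winner-correct R x)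
    ; run-games = λ k x → trans (run-games L _ x)
        (trans (run-games R _ x) (run-match (winner L x) (winner R x) k x))
    ; participation-∈ = ∈
    ; participation-∉ = ∉
    }
    where
    open ≤-Reasoning
    bracket : (Maybe (Fin n) → Alg n) → Alg n
    bracket k = games L (λ u → games R (λ v → match u v k))

    module _ (k : Maybe (Fin n) → Alg n) (x : Input n) where
      wL = winner L x
      wR = winner R x
      after = participation (k (better x wL wR)) x

      ∈ : ∀ {e} → (P ∪ Q) e → participation (bracket k) x e ≤ suc d + after e
      ∈ {e} (inj₁ Pe) = begin
        participation (bracket k) x e                        ≤⟨ participation-∈ L _ x Pe ⟩
        d + participation (games R (λ v → match wL v k)) x e ≡⟨ cong (d +_) (participation-∉ R _ x ¬Qe) ⟩
        d + participation (match wL wR k) x e                ≤⟨ +-monoʳ-≤ d (participation-match wL wR k x e) ⟩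
        d + suc (after e)                                    ≡⟨ +-suc d (after e) ⟩
        suc d + after e                                      ∎
        where
        ¬Qe : ¬ Q e
        ¬Qe Qe = P⊥Q (Pe , Qe)
      ∈ {e} (inj₂ Qe) = begin
        participation (bracket k) x e                    ≡⟨ participation-∉ L _ x ¬Pe ⟩
        participation (games R (λ v → match wL v k)) x e ≤⟨ participation-∈ R _ x Qe ⟩
        d + participation (match wL wR k) x e            ≤⟨ +-monoʳ-≤ d (participation-match wL wR k x e) ⟩
        d + suc (after e)                                ≡⟨ +-suc d (after e) ⟩
        suc d + after e                                  ∎
        where
        ¬Pe : ¬ P e
        ¬Pe Pe = P⊥Q (Pe , Qe)

      ∉ : ∀ {e} → ¬ (P ∪ Q) e → participation (bracket k) x e ≡ after e
      ∉ {e} ¬P∪Q = begin-equality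
        participation (bracket k) x e                    ≡⟨ participation-∉ L _ x (¬P∪Q ∘ inj₁) ⟩
        participation (games R (λ v → match wL v k)) x e ≡⟨ participation-∉ R _ x (¬P∪Q ∘ inj₂) ⟩
        participation (match wL wR k) x e                ≡⟨ participation-match-∉ wL wR k x e wL≢e wR≢e ⟩
        after e                                          ∎
        where
        wL≢e = winner-∉ (winner-correct L x) (¬P∪Q ∘ inj₁)
        wR≢e = winner-∉ (winner-correct R x) (¬P∪Q ∘ inj₂)

  reindex : ∀ {P Q d} → P ≐ Q → Tournament P d → Tournament Q d
  reindex (P⊆Q , Q⊆P) T = record
    { games = games T
    ; winner = winner T
    ; winner-correct = λ x → transport (winner T x) (winner-correct T x)
    ; run-games = run-games T
    ; participation-∈ = λ k x → participation-∈ T k x ∘ Q⊆P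
    ; participation-∉ = λ k x ¬Qe → participation-∉ T k x (¬Qe ∘ P⊆Q)
    }
    where
    transport : ∀ {x} w → Winner _ x w → Winner _ x w
    transport nothing ∅P e Qe = ∅P e (Q⊆P Qe)
    transport (just m) (Pm , m-min) = P⊆Q Pm , m-min ∘ Q⊆P

  Interval : ℕ → ℕ → Pred (Fin n) 0ℓ
  Interval lo hi e = lo ≤ toℕ e × toℕ e < hi

  interval-∪ : ∀ {lo mid hi} → lo ≤ mid → mid ≤ hi →
    Interval lo mid ∪ Interval mid hi ≐ Interval lo hi
  interval-∪ {mid = mid} lo≤mid mid≤hi = merge , split
    where
    split : Interval _ _ ⊆ Interval _ mid ∪ Interval mid _
    split {e} (lo≤e , e<hi) with toℕ e <? mid
    ... | yes e<mid = inj₁ (lo≤e , e<mid)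
    ... | no e≮mid = inj₂ (≮⇒≥ e≮mid , e<hi)
    merge : Interval _ mid ∪ Interval mid _ ⊆ Interval _ _
    merge (inj₁ (lo≤e , e<mid)) = lo≤e , <-≤-trans e<mid mid≤hi
    merge (inj₂ (mid≤e , e<hi)) = ≤-trans lo≤mid mid≤e , e<hi

  interval-disjoint : ∀ {lo mid hi} → Interval lo mid ⊥ Interval mid hi
  interval-disjoint ((_ , e<mid) , (mid≤e , _)) = <⇒≱ e<mid mid≤e

  unit-interval : ∀ {lo e} → Interval lo (lo + 1) e → toℕ e ≡ lo
  unit-interval {lo} {e} (lo≤e , e<lo+1) = ≤-antisym (≤-pred (subst (toℕ e <_) (+-comm lo 1) e<lo+1)) lo≤e

  interval-tournament : ∀ d lo → Tournament (Interval lo (lo + 2 ^ d)) d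
  interval-tournament zero lo with lo <? n
  ... | yes lo<n = walkover (just e₀) λ x → (lo≤e₀ , e₀<lo+1) , λ Ie → ≤-reflexive (cong x (only Ie))
    where
    e₀ = fromℕ< lo<n
    lo≤e₀ : lo ≤ toℕ e₀
    lo≤e₀ = ≤-reflexive (sym (toℕ-fromℕ< lo<n))
    e₀<lo+1 : toℕ e₀ < lo + 1
    e₀<lo+1 = subst (_< lo + 1) (sym (toℕ-fromℕ< lo<n)) (subst (lo <_) (+-comm 1 lo) ≤-refl)
    only : ∀ {e} → Interval lo (lo + 1) e → e₀ ≡ e
    only Ie = toℕ-injective (trans (toℕ-fromℕ< lo<n) (sym (unit-interval Ie)))
  ... | no lo≮n = walkover nothing λ x e Ie → lo≮n (subst (_< n) (unit-interval Ie) (toℕ<n e))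
  interval-tournament (suc d) lo =
    subst (λ hi → Tournament (Interval lo hi) (suc d)) (sym lo+2^[1+d]≡lo+2^d+2^d)
      (reindex (interval-∪ (m≤m+n lo (2 ^ d)) (m≤m+n (lo + 2 ^ d) (2 ^ d)))
        (finalMatch interval-disjoint (interval-tournament d lo) (interval-tournament d (lo + 2 ^ d))))
    where
    lo+2^[1+d]≡lo+2^d+2^d : lo + 2 ^ suc d ≡ lo + 2 ^ d + 2 ^ d
    lo+2^[1+d]≡lo+2^d+2^d = trans (cong (λ m → lo + (2 ^ d + m)) (+-identityʳ (2 ^ d))) (sym (+-assoc lo _ _))

module _ {n : ℕ} (1≤n : 1 ≤ n) where
  open Tournament

  private
    D = ⌈log₂ n ⌉

    knockout : Tournament (Interval {n} 0 (2 ^ D)) D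
    knockout = interval-tournament D 0

    everyone : ∀ e → Interval 0 (2 ^ D) e
    everyone e = z≤n , <-≤-trans (toℕ<n e) (n≤2^⌈log₂n⌉ n)

    announce : Maybe (Fin n) → Alg n
    announce nothing = out (fromℕ< 1≤n)
    announce (just w) = out w

    announce-silent : ∀ w x k → participation (announce w) x k ≡ 0
    announce-silent nothing x k = refl
    announce-silent (just w) x k = refl

    announce-min : ∀ x w → Winner (Interval 0 (2 ^ D)) x w → IsMinPos x (run (announce w) x)
    announce-min x nothing ∅ = ⊥-elim (∅ _ (everyone (fromℕ< 1≤n)))
    announce-min x (just w) (_ , w-min) j = w-min (everyone j)

  knockout-upper-bound : Σ (Alg n) λ A → FindsMin A ×
    ((x : Input n) → Distinct x → (k : Fin n) → participation A x k ≤ D)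
  knockout-upper-bound = games knockout announce , finds , bound
    where
    finds : FindsMin (games knockout announce)
    finds x _ = subst (IsMinPos x) (sym (run-games knockout announce x))
      (announce-min x (winner knockout x) (winner-correct knockout x))
    bound : ∀ x → Distinct x → ∀ k → participation (games knockout announce) x k ≤ D
    bound x _ k = ≤-trans (participation-∈ knockout announce x (everyone k))
      (≤-reflexive (trans (cong (D +_) (announce-silent (winner knockout x) x k)) (+-identityʳ D)))

module _ {n : ℕ} where

  -- death k ≡ just t: k lost a duel at time t (nothing while k is still a candidate);
  -- weight k counts the elements k has absorbed, itself included.
  record Board : Set where
    constructor board
    field
      death : Fin n → Maybe ℕ
      weight : Fin n → ℕ
      clock : ℕ

  open Board

  Alive : Board → Fin n → Set
  Alive σ k = death σ k ≡ nothing

  eliminate : Board → Fin n → Fin n → Board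
  eliminate σ a b = board (λ k → if does (k ≟ b) then just (clock σ) else death σ k)
                          (transfer a b (weight σ)) (suc (clock σ))

  death-eliminated : ∀ σ a b → death (eliminate σ a b) b ≡ just (clock σ)
  death-eliminated σ a b with b ≟ b
  ... | yes _ = refl
  ... | no b≢b = ⊥-elim (b≢b refl)

  death-spared : ∀ σ a b {k} → k ≢ b → death (eliminate σ a b) k ≡ death σ k
  death-spared σ a b {k} k≢b with k ≟ b
  ... | yes k≡b = ⊥-elim (k≢b k≡b)
  ... | no _ = refl

  record WellFormed (σ : Board) : Set where
    field
      stamp<clock : ∀ {k t} → death σ k ≡ just t → t < clock σ
      dead-weightless : ∀ {k t} → death σ k ≡ just t → weight σ k ≡ 0
      stamp-injective : ∀ {k k′ t} → death σ k ≡ just t → death σ k′ ≡ just t → k ≡ k′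
      weight-total : sum (weight σ) ≡ n

  record Respects (σ : Board) (x : Input n) : Set where
    field
      alive<dead : ∀ {i j t} → Alive σ i → death σ j ≡ just t → x i < x j
      later<earlier : ∀ {i j a b} → death σ i ≡ just a → death σ j ≡ just b → b < a → x i < x j

  open WellFormed
  open Respects

  dead≢alive : ∀ {σ j b t} → death σ j ≡ just t → Alive σ b → j ≢ b
  dead≢alive dj ab refl with () ← trans (sym dj) ab

  eliminate-wf : ∀ {σ a b} → WellFormed σ → Alive σ a → Alive σ b → a ≢ b →
    WellFormed (eliminate σ a b)
  eliminate-wf {σ} {a} {b} wf aa ab a≢b = record
    { stamp<clock = stamp<clock′
    ; dead-weightless = dead-weightless′
    ; stamp-injective = stamp-injective′
    ; weight-total = trans (sum-transfer (weight σ) a≢b) (weight-total wf)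
    }
    where
    σ′ = eliminate σ a b
    stamp<clock′ : ∀ {k t} → death σ′ k ≡ just t → t < clock σ′
    stamp<clock′ {k} dk with k ≟ b | dk
    ... | yes _ | refl = ≤-refl
    ... | no _ | dk′ = m<n⇒m<1+n (stamp<clock wf dk′)
    dead-weightless′ : ∀ {k t} → death σ′ k ≡ just t → weight σ′ k ≡ 0
    dead-weightless′ {k} dk with k ≟ a | k ≟ b
    ... | yes refl | no _ with () ← trans (sym dk) aa
    ... | yes refl | yes refl = ⊥-elim (a≢b refl)
    ... | no _ | yes _ = refl
    ... | no _ | no _ = dead-weightless wf dk
    stamp-injective′ : ∀ {k k′ t} → death σ′ k ≡ just t → death σ′ k′ ≡ just t → k ≡ k′
    stamp-injective′ {k} {k′} dk dk′ with k ≟ b | k′ ≟ b | dk | dk′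
    ... | yes k≡b | yes k′≡b | _ | _ = trans k≡b (sym k′≡b)
    ... | yes _ | no _ | refl | dk″ = ⊥-elim (<-irrefl refl (stamp<clock wf dk″))
    ... | no _ | yes _ | dk″ | refl = ⊥-elim (<-irrefl refl (stamp<clock wf dk″))
    ... | no _ | no _ | dk″ | dk‴ = stamp-injective wf dk″ dk‴

  eliminate-alive : ∀ σ a b {k} → Alive (eliminate σ a b) k → Alive σ k
  eliminate-alive σ a b {k} ak with k ≟ b | ak
  ... | yes _ | ()
  ... | no _ | ak′ = ak′

  eliminate-respects : ∀ {σ a b x} → WellFormed σ → Alive σ b →
    Respects (eliminate σ a b) x → Respects σ x
  eliminate-respects {σ} {a} {b} {x} wf ab ρ =
    record { alive<dead = alive<dead′ ; later<earlier = later<earlier′ }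
    where
    spared : ∀ {j t} → death σ j ≡ just t → death (eliminate σ a b) j ≡ just t
    spared dj = trans (death-spared σ a b (dead≢alive {σ} dj ab)) dj
    alive<dead′ : ∀ {i j t} → Alive σ i → death σ j ≡ just t → x i < x j
    alive<dead′ {i} ai dj with i ≟ b
    ... | yes refl = later<earlier ρ (death-eliminated σ a b) (spared dj) (stamp<clock wf dj)
    ... | no i≢b = alive<dead ρ (trans (death-spared σ a b i≢b) ai) (spared dj)
    later<earlier′ : ∀ {i j s t} → death σ i ≡ just s → death σ j ≡ just t → t < s → x i < x j
    later<earlier′ di dj = later<earlier ρ (spared di) (spared dj)

  eliminate-weight : ∀ σ a b {k} → weight σ b ≤ weight σ a → Alive (eliminate σ a b) k →
    weight (eliminate σ a b) k ≤ weight σ k * 2 ^ touches a b k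
  eliminate-weight σ a b {k} wb≤wa ak with k ≟ a | k ≟ b | ak
  ... | yes refl | _ | _ = begin
    weight σ a + weight σ b        ≤⟨ +-monoʳ-≤ (weight σ a) wb≤wa ⟩
    weight σ a + weight σ a        ≡⟨ cong (weight σ a +_) (+-identityʳ (weight σ a)) ⟨
    2 * weight σ a                 ≡⟨ *-comm 2 (weight σ a) ⟩
    weight σ a * 2 ^ 1             ≡⟨ cong (λ e → weight σ a * 2 ^ e) (touches-left a b) ⟨
    weight σ a * 2 ^ touches a b a ∎
    where open ≤-Reasoning
  ... | no _ | yes _ | ()
  ... | no _ | no _ | _ = m≤m*2^e (weight σ k) (touches a b k)

  data Move (σ : Board) (i j : Fin n) : Bool → Board → Set where
    self : i ≡ j → Move σ i j false σ
    beats : Alive σ i → Alive σ j → i ≢ j → weight σ j ≤ weight σ i →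
      Move σ i j true (eliminate σ i j)
    beaten : Alive σ i → Alive σ j → i ≢ j → weight σ i ≤ weight σ j →
      Move σ i j false (eliminate σ j i)
    alive-dead : ∀ {t} → Alive σ i → death σ j ≡ just t → Move σ i j true σ
    dead-alive : ∀ {t} → death σ i ≡ just t → Alive σ j → Move σ i j false σ
    dead-dead : ∀ {s t} → death σ i ≡ just s → death σ j ≡ just t → Move σ i j (does (t <? s)) σ

  answer : ∀ σ i j → Σ Bool λ b → Σ Board (Move σ i j b)
  answer σ i j with death σ i in di | death σ j in dj
  ... | nothing | nothing with i ≟ j
  ...   | yes i≡j = false , σ , self i≡j
  ...   | no i≢j with weight σ j ≤? weight σ i
  ...     | yes wj≤wi = true , eliminate σ i j , beats di dj i≢j wj≤wi
  ...     | no wj≰wi = false , eliminate σ j i , beaten di dj i≢j (<⇒≤ (≰⇒> wj≰wi))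
  answer σ i j | nothing | just t = true , σ , alive-dead di dj
  answer σ i j | just s | nothing = false , σ , dead-alive di dj
  answer σ i j | just s | just t = does (t <? s) , σ , dead-dead di dj

  module _ {σ : Board} {i j : Fin n} {b : Bool} {σ′ : Board} where

    move-wf : Move σ i j b σ′ → WellFormed σ → WellFormed σ′
    move-wf (beats ai aj i≢j _) wf = eliminate-wf wf ai aj i≢j
    move-wf (beaten ai aj i≢j _) wf = eliminate-wf wf aj ai (i≢j ∘ sym)
    move-wf (self _) wf = wf
    move-wf (alive-dead _ _) wf = wf
    move-wf (dead-alive _ _) wf = wf
    move-wf (dead-dead _ _) wf = wf

    move-alive : ∀ {k} → Move σ i j b σ′ → Alive σ′ k → Alive σ k
    move-alive (beats _ _ _ _) = eliminate-alive σ i j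
    move-alive (beaten _ _ _ _) = eliminate-alive σ j i
    move-alive (self _) ak = ak
    move-alive (alive-dead _ _) ak = ak
    move-alive (dead-alive _ _) ak = ak
    move-alive (dead-dead _ _) ak = ak

    move-respects : ∀ {x} → Move σ i j b σ′ → WellFormed σ → Respects σ′ x → Respects σ x
    move-respects (beats _ aj _ _) wf = eliminate-respects wf aj
    move-respects (beaten ai _ _ _) wf = eliminate-respects wf ai
    move-respects (self _) _ ρ = ρ
    move-respects (alive-dead _ _) _ ρ = ρ
    move-respects (dead-alive _ _) _ ρ = ρ
    move-respects (dead-dead _ _) _ ρ = ρ

    move-weight : ∀ {k} → Move σ i j b σ′ → Alive σ′ k → weight σ′ k ≤ weight σ k * 2 ^ touches i j k
    move-weight (beats _ _ _ wj≤wi) ak = eliminate-weight σ i j wj≤wi ak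
    move-weight {k} (beaten _ _ _ wi≤wj) ak =
      subst (λ e → weight σ′ k ≤ weight σ k * 2 ^ e) (touches-comm j i k) (eliminate-weight σ j i wi≤wj ak)
    move-weight {k} (self _) _ = m≤m*2^e (weight σ k) (touches i j k)
    move-weight {k} (alive-dead _ _) _ = m≤m*2^e (weight σ k) (touches i j k)
    move-weight {k} (dead-alive _ _) _ = m≤m*2^e (weight σ k) (touches i j k)
    move-weight {k} (dead-dead _ _) _ = m≤m*2^e (weight σ k) (touches i j k)

    move-consistent : ∀ {x} → Move σ i j b σ′ → WellFormed σ → Respects σ′ x → does (x i <? x j) ≡ b
    move-consistent {x} (self refl) _ _ = dec-false (x i <? x i) (<-irrefl refl)
    move-consistent {x} (beats ai _ i≢j _) _ ρ =
      dec-true (x i <? x j) (alive<dead ρ (trans (death-spared σ i j i≢j) ai) (death-eliminated σ i j))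
    move-consistent {x} (beaten _ aj i≢j _) _ ρ =
      dec-false (x i <? x j)
        (<-asym (alive<dead ρ (trans (death-spared σ j i (i≢j ∘ sym)) aj) (death-eliminated σ j i)))
    move-consistent {x} (alive-dead ai dj) _ ρ = dec-true (x i <? x j) (alive<dead ρ ai dj)
    move-consistent {x} (dead-alive di aj) _ ρ = dec-false (x i <? x j) (<-asym (alive<dead ρ aj di))
    move-consistent {x} (dead-dead {s} {t} di dj) wf ρ with does (t <? s) | proof (t <? s)
    ... | true | ofʸ t<s = dec-true (x i <? x j) (later<earlier ρ di dj t<s)
    ... | false | ofⁿ t≮s = dec-false (x i <? x j) xi≮xj
      where
      xi≮xj : ¬ x i < x j
      xi≮xj with m≤n⇒m<n∨m≡n (≮⇒≥ t≮s)
      ... | inj₁ s<t = <-asym (later<earlier ρ dj di s<t)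
      ... | inj₂ refl with refl ← stamp-injective wf di dj = <-irrefl refl

  play : Alg n → Board → Fin n × Board
  play (out m) σ = m , σ
  play (cmp i j l r) σ with answer σ i j
  ... | true , σ′ , _ = play l σ′
  ... | false , σ′ , _ = play r σ′

  verdict : Alg n → Board → Fin n
  verdict A σ = proj₁ (play A σ)

  final : Alg n → Board → Board
  final A σ = proj₂ (play A σ)

  play-wf : ∀ A σ → WellFormed σ → WellFormed (final A σ)
  play-wf (out _) σ wf = wf
  play-wf (cmp i j l r) σ wf with answer σ i j
  ... | true , σ′ , μ = play-wf l σ′ (move-wf μ wf)
  ... | false , σ′ , μ = play-wf r σ′ (move-wf μ wf)

  play-alive : ∀ A σ {k} → Alive (final A σ) k → Alive σ k
  play-alive (out _) σ ak = ak
  play-alive (cmp i j l r) σ ak with answer σ i j | ak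
  ... | true , σ′ , μ | ak′ = move-alive μ (play-alive l σ′ ak′)
  ... | false , σ′ , μ | ak′ = move-alive μ (play-alive r σ′ ak′)

  play-respects : ∀ A σ {x} → WellFormed σ → Respects (final A σ) x → Respects σ x
  play-respects (out _) σ wf ρ = ρ
  play-respects (cmp i j l r) σ wf ρ with answer σ i j | ρ
  ... | true , σ′ , μ | ρ′ = move-respects μ wf (play-respects l σ′ (move-wf μ wf) ρ′)
  ... | false , σ′ , μ | ρ′ = move-respects μ wf (play-respects r σ′ (move-wf μ wf) ρ′)

  move-consistent-final : ∀ {σ i j b σ′ x} t → Move σ i j b σ′ → WellFormed σ →
    Respects (final t σ′) x → does (x i <? x j) ≡ b
  move-consistent-final t μ wf ρ = move-consistent μ wf (play-respects t _ (move-wf μ wf) ρ)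

  play-run : ∀ A σ {x} → WellFormed σ → Respects (final A σ) x → run A x ≡ verdict A σ
  play-run (out _) σ wf ρ = refl
  play-run (cmp i j l r) σ {x} wf ρ with answer σ i j | ρ
  ... | true , σ′ , μ | ρ′ =
    trans (run-cmp i j l r x (move-consistent-final l μ wf ρ′)) (play-run l σ′ (move-wf μ wf) ρ′)
  ... | false , σ′ , μ | ρ′ =
    trans (run-cmp i j l r x (move-consistent-final r μ wf ρ′)) (play-run r σ′ (move-wf μ wf) ρ′)

  play-weight : ∀ A σ {x k} → WellFormed σ → Respects (final A σ) x → Alive (final A σ) k →
    weight (final A σ) k ≤ weight σ k * 2 ^ participation A x k
  play-weight (out _) σ {k = k} _ _ _ = m≤m*2^e (weight σ k) 0
  play-weight (cmp i j l r) σ {x} {k} wf ρ ak with answer σ i j | ρ | ak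
  ... | true , σ′ , μ | ρ′ | ak′ =
    subst (λ p → weight (final l σ′) k ≤ weight σ k * 2 ^ p)
      (sym (participation-cmp i j l r x k (move-consistent-final l μ wf ρ′)))
      (*2^-trans {c = weight σ k} (participation l x k) (touches i j k)
        (play-weight l σ′ (move-wf μ wf) ρ′ ak′) (move-weight μ (play-alive l σ′ ak′)))
  ... | false , σ′ , μ | ρ′ | ak′ =
    subst (λ p → weight (final r σ′) k ≤ weight σ k * 2 ^ p)
      (sym (participation-cmp i j l r x k (move-consistent-final r μ wf ρ′)))
      (*2^-trans {c = weight σ k} (participation r x k) (touches i j k)
        (play-weight r σ′ (move-wf μ wf) ρ′ ak′) (move-weight μ (play-alive r σ′ ak′)))

  realise : (Fin n → ℕ) → Board → Input n
  realise f σ k with death σ k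
  ... | nothing = f k
  ... | just t = n + (clock σ ∸ t)

  realise-alive : ∀ f σ {k} → Alive σ k → realise f σ k ≡ f k
  realise-alive f σ ak rewrite ak = refl

  realise-dead : ∀ f σ {k t} → death σ k ≡ just t → realise f σ k ≡ n + (clock σ ∸ t)
  realise-dead f σ dk rewrite dk = refl

  Ranking : (Fin n → ℕ) → Set
  Ranking f = (∀ k → f k < n) × Injective _≡_ _≡_ f

  realise-respects : ∀ {f σ} → WellFormed σ → Ranking f → Respects σ (realise f σ)
  realise-respects {f} {σ} wf (f<n , _) = record
    { alive<dead = λ {i} ai dj →
        subst₂ _<_ (sym (realise-alive f σ ai)) (sym (realise-dead f σ dj)) (<-≤-trans (f<n i) (m≤m+n n _))
    ; later<earlier = λ di dj t<s → subst₂ _<_ (sym (realise-dead f σ di)) (sym (realise-dead f σ dj))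
        (+-monoʳ-< n (∸-monoʳ-< t<s (<⇒≤ (stamp<clock wf di))))
    }

  realise-distinct : ∀ {f σ} → WellFormed σ → Ranking f → Distinct (realise f σ)
  realise-distinct {f} {σ} wf (f<n , f-inj) {a} {b} eq with death σ a in da | death σ b in db
  ... | nothing | nothing = f-inj eq
  ... | nothing | just _ = ⊥-elim (<⇒≱ (f<n a) (subst (n ≤_) (sym eq) (m≤m+n n _)))
  ... | just _ | nothing = ⊥-elim (<⇒≱ (f<n b) (subst (n ≤_) eq (m≤m+n n _)))
  ... | just s | just t
    with refl ← ∸-cancelˡ-≡ (<⇒≤ (stamp<clock wf da)) (<⇒≤ (stamp<clock wf db)) (+-cancelˡ-≡ n _ _ eq)
    = stamp-injective wf da db

  start : Board
  start = board (λ _ → nothing) (λ _ → 1) 0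

  start-wf : WellFormed start
  start-wf = record
    { stamp<clock = λ ()
    ; dead-weightless = λ ()
    ; stamp-injective = λ ()
    ; weight-total = sum-ones n
    }

  toℕ-ranking : Ranking toℕ
  toℕ-ranking = toℕ<n , toℕ-injective

  opposite-ranking : Ranking (toℕ ∘ opposite)
  opposite-ranking = toℕ<n ∘ opposite , λ {a} {b} eq →
    trans (sym (opposite-involutive a)) (trans (cong opposite (toℕ-injective eq)) (opposite-involutive b))

  adversary-lower-bound : 1 ≤ n → (A : Alg n) → FindsMin A →
    Σ (Input n) λ x → Distinct x × Σ (Fin n) λ m → IsMinPos x m × (⌈log₂ n ⌉ ≤ participation A x m)
  adversary-lower-bound 1≤n A finds =
    realise toℕ σ , realise-distinct wf toℕ-ranking , m , minimal toℕ-ranking , ⌈log₂⌉-≤ n≤2^p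
    where
    σ = final A start
    m = verdict A start
    wf = play-wf A start start-wf

    minimal : ∀ {f} → Ranking f → IsMinPos (realise f σ) m
    minimal rk = subst (IsMinPos _) (play-run A start start-wf (realise-respects wf rk))
                   (finds _ (realise-distinct wf rk))

    -- Rankings that order the candidates in opposite ways both make m the minimum.
    survivor : ∀ {k} → Alive σ k → k ≡ m
    survivor {k} ak with death σ m in dm
    ... | just _ = ⊥-elim (<⇒≱ (alive<dead (realise-respects wf toℕ-ranking) ak dm) (minimal toℕ-ranking k))
    ... | nothing = toℕ-injective (≤-antisym k≤m m≤k)
      where
      m≤k : toℕ m ≤ toℕ k
      m≤k = subst₂ _≤_ (realise-alive toℕ σ dm) (realise-alive toℕ σ ak) (minimal toℕ-ranking k)
      k≤m : toℕ k ≤ toℕ m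
      k≤m = opposite-reverses
        (subst₂ _≤_ (realise-alive _ σ dm) (realise-alive _ σ ak) (minimal opposite-ranking k))

    weight-m : weight σ m ≡ n
    weight-m = trans (sym (sum-concentrated (weight σ) m eliminated)) (weight-total wf)
      where
      eliminated : ∀ k → k ≢ m → weight σ k ≡ 0
      eliminated k k≢m with death σ k in dk
      ... | nothing = ⊥-elim (k≢m (survivor dk))
      ... | just _ = dead-weightless wf dk

    m-alive : Alive σ m
    m-alive with death σ m in dm
    ... | nothing = refl
    ... | just _ = ⊥-elim (<⇒≱ 1≤n (≤-reflexive (trans (sym weight-m) (dead-weightless wf dm))))

    n≤2^p : n ≤ 2 ^ participation A (realise toℕ σ) m
    n≤2^p = subst₂ _≤_ weight-m (*-identityˡ _)
      (play-weight A start start-wf (realise-respects wf toℕ-ranking) m-alive)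

theorem2 : (n : ℕ) → 1 ≤ n →
    (Σ (Alg n) λ A → FindsMin A ×
    ((x : Input n) → Distinct x → (k : Fin n) → participation A x k ≤ ⌈log₂ n ⌉))
    ×
    ((A : Alg n) → FindsMin A →
    Σ (Input n) λ x → Distinct x × Σ (Fin n) λ m → IsMinPos x m × (⌈log₂ n ⌉ ≤ participation A x m))
theorem2 n 1≤n = knockout-upper-bound 1≤n , adversary-lower-bound 1≤n
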